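{- Let $Q\in\{47058,\ 2214502422\}$ and $\mathfrak{N}_Q=\{n\in\mathbb{N}: S_{Qn}(Qn)\equiv n\pmod{Qn}\}$. Then $$\{5k:k\in\mathbb{N}\}\setminus\mathfrak{N}_Q=\bigcup_{d\mid Q}W^{(1)}_d(Q)\cup\bigcup_{d\mid Q}W^{(2)}_d(Q),$$ where $$W^{(1)}_d(Q)=\left\{K\frac{p(p-1)}{d}: p\text{ prime},\ p\nmid Q,\ 5\mid p(p-1),\ d\mid p-1,\ K\in\mathbb{N}\right\},$$ $$W^{(2)}_d(Q)=\left\{5K\frac{p(p-1)}{d}: p\text{ prime},\ p\nmid Q,\ 5\nmid p(p-1),\ d\mid p-1,\ K\in\mathbb{N}\right\}.$$
   Context: $\mathbb{N}=\{1,2,3,\dots\}$. For positive integers $m,k$, $S_m(k):=1^m+2^m+\cdots+k^m$. The unions are over positive divisors $d$ of $Q$. -}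

module Defs where

open import Data.Nat using (ℕ; zero; suc; _+_; _*_; _∸_; _^_; _≥_)
open import Data.Nat.Divisibility using (_∣_)
open import Data.Nat.Primality using (Prime)
open import Data.Integer as ℤ using (ℤ; +_)
import Data.Integer.Divisibility as ℤDiv
open import Data.Product using (Σ; _×_)
open import Relation.Nullary using (¬_)

S : ℕ → ℕ → ℕ
S m zero    = 0
S m (suc k) = S m k + suc k ^ m

_≡_[mod_] : ℕ → ℕ → ℕ → Set
a ≡ b [mod m ] = (+ m) ℤDiv.∣ ((+ a) ℤ.- (+ b))

-- membership of n in 𝔑_Q  (n ∈ ℕ = {1,2,...})
InN : ℕ → ℕ → Set
InN Q n = (n ≥ 1) × (S (Q * n) (Q * n) ≡ n [mod Q * n ])

-- m ∈ W^(1)_d(Q):  m = K * (p(p-1)/d), written as m * d = K * (p(p-1)), with d ∣ p-1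
W1 : ℕ → ℕ → ℕ → Set
W1 Q d m = Σ ℕ λ p → Σ ℕ λ K →
  Prime p × ¬ (p ∣ Q) × (5 ∣ p * (p ∸ 1)) × (d ∣ p ∸ 1) × (K ≥ 1) ×
  (m * d ≡ K * (p * (p ∸ 1)))
  where open import Relation.Binary.PropositionalEquality using (_≡_)

W2 : ℕ → ℕ → ℕ → Set
W2 Q d m = Σ ℕ λ p → Σ ℕ λ K →
  Prime p × ¬ (p ∣ Q) × ¬ (5 ∣ p * (p ∸ 1)) × (d ∣ p ∸ 1) × (K ≥ 1) ×
  (m * d ≡ 5 * K * (p * (p ∸ 1)))
  where open import Relation.Binary.PropositionalEquality using (_≡_)

{-# OPTIONS --safe #-}
module Submission where

-- Write N = Q m and N = L p^(e+1) with p ∤ L. Since p ∣ N, (b p^(e+1) + a)^N ≡ a^N (mod p^(e+2)),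
-- so by periodicity S_N(N) ≡ L p^e ∑_{k<p} k^N (mod p^(e+1)). Modulo p that power sum is p − 1
-- when (p − 1) ∣ N (Fermat) and 0 otherwise, because ∑_{k<p} k^r ≡ 0 for r < p − 1 (from the
-- recurrence ∑_{j≤r} C(r+1,j) ∑_{k<p} k^j = p^(r+1)). Hence a prime p ∤ Q with p ∣ m and
-- (p − 1) ∣ N obstructs S_N(N) ≡ m (mod N): that would force p ∣ L (p − 1). Conversely, if 5 ∣ m
-- and no prime obstructs, S_N(N) ≡ m holds modulo every prime power of N: for p ∤ Q both sides
-- vanish, and for p ∣ Q the conditions (p − 1) ∣ 5Q and p ∣ Q/p + 1 give
-- L p^e (p − 1) = m (Q/p) (p − 1) ≡ m. Finally the obstructed m are exactly the elements of the
-- sets W, with d = gcd(Q, p − 1).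

open import Defs
open import Data.Integer as ℤ using (ℤ)
import Data.Integer.Divisibility.Signed as ℤ
import Data.Integer.Properties as ℤ
import Data.Integer.Tactic.RingSolver as ℤ
open import Data.List using ([]; _∷_)
open import Data.List.Relation.Unary.All as All using (All; _∷_)
open import Data.Nat
open import Data.Nat.Combinatorics
  using (_C_; nCk+nC[k+1]≡[n+1]C[k+1]; k>n⇒nCk≡0; nCn≡1; nC1≡n; nCk≡nC[n∸k])
open import Data.Nat.Divisibility
open import Data.Nat.DivMod using (_%_; _/_; m≡m%n+[m/n]*n; m%n<n)
open import Data.Nat.GCD
  using (gcd; gcd[m,n]∣m; gcd[m,n]∣n; gcd[m,n]≢0; gcd-greatest; c*gcd[m,n]≡gcd[cm,cn])
open import Data.Nat.Induction using (<-rec)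
open import Data.Nat.ListAction using (product)
open import Data.Nat.Primality
open import Data.Nat.Primality.Factorisation using (factorise; factorisationHasAllPrimeFactors)
open import Data.Nat.Properties
open import Data.Nat.Tactic.RingSolver using (solve-∀)
open import Data.Product using (Σ; _×_; _,_; proj₁; proj₂)
open import Data.Sum using (_⊎_; inj₁; inj₂; [_,_]′)
open import Function using (_∘_; id; _⇔_; mk⇔)
open import Level using (0ℓ)
open import Relation.Binary.Bundles using (Setoid)
open import Relation.Binary.PropositionalEquality
import Relation.Binary.Reasoning.Setoid as SetoidReasoning
open import Relation.Binary.Structures using (IsEquivalence)
open import Relation.Nullary using (¬_; ¬?; Dec; yes; no; _×-dec_; contradiction)
open import Relation.Nullary.Decidable using (from-yes; from-no)

private
  variable
    a b c d e k m n p q t x L M N Q : ℕ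

-- Congruences

-- a ≡ b [mod n ] computes to a divisibility statement, so Agda cannot infer a, b and n
-- from it; this wrapper restores inference.
infix 4 _≈_[mod_]
record _≈_[mod_] (a b n : ℕ) : Set where
  constructor ≈-mod
  field ≡-mod : a ≡ b [mod n ]
open _≈_[mod_] public

private
  diff : ℕ → ℕ → ℤ
  diff a b = ℤ.+ a ℤ.- ℤ.+ b

  fromSigned : ∀ {z} → diff a b ≡ z → ℤ.+ n ℤ.∣ z → a ≈ b [mod n ]
  fromSigned refl n∣z = ≈-mod (ℤ.∣⇒∣ᵤ n∣z)

  toSigned : a ≈ b [mod n ] → ℤ.+ n ℤ.∣ diff a b
  toSigned (≈-mod a≡b) = ℤ.∣ᵤ⇒∣ a≡b

  ∣diff-scaled∣ : ∀ c a b → ℤ.∣ diff (c * a) (c * b) ∣ ≡ c * ℤ.∣ diff a b ∣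
  ∣diff-scaled∣ c a b = trans (cong ℤ.∣_∣ diff-scaled) (ℤ.abs-* (ℤ.+ c) (diff a b))
    where
      factor : ∀ (i j k : ℤ) → i ℤ.* j ℤ.- i ℤ.* k ≡ i ℤ.* (j ℤ.- k)
      factor = ℤ.solve-∀
      diff-scaled : diff (c * a) (c * b) ≡ ℤ.+ c ℤ.* diff a b
      diff-scaled rewrite ℤ.pos-* c a | ℤ.pos-* c b = factor (ℤ.+ c) (ℤ.+ a) (ℤ.+ b)

≡⇒≈ : a ≡ b → a ≈ b [mod n ]
≡⇒≈ {a = a} {n = n} refl = ≈-mod (subst (n ∣_) (cong ℤ.∣_∣ (sym (ℤ.+-inverseʳ (ℤ.+ a)))) (n ∣0))

≈-refl : a ≈ a [mod n ]
≈-refl = ≡⇒≈ refl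

≈-sym : a ≈ b [mod n ] → b ≈ a [mod n ]
≈-sym {a = a} {b = b} a≈b = fromSigned (swap (ℤ.+ a) (ℤ.+ b)) (ℤ.∣m⇒∣-m (toSigned a≈b))
  where swap : ∀ (i j : ℤ) → j ℤ.- i ≡ ℤ.- (i ℤ.- j)
        swap = ℤ.solve-∀

≈-trans : a ≈ b [mod n ] → b ≈ c [mod n ] → a ≈ c [mod n ]
≈-trans {a = a} {b = b} {c = c} a≈b b≈c =
  fromSigned (telescope (ℤ.+ a) (ℤ.+ b) (ℤ.+ c)) (ℤ.∣m∣n⇒∣m+n (toSigned a≈b) (toSigned b≈c))
  where telescope : ∀ (i j k : ℤ) → i ℤ.- k ≡ (i ℤ.- j) ℤ.+ (j ℤ.- k)
        telescope = ℤ.solve-∀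

≈-isEquivalence : IsEquivalence (λ a b → a ≈ b [mod n ])
≈-isEquivalence = record { refl = ≈-refl ; sym = ≈-sym ; trans = ≈-trans }

≈-setoid : ℕ → Setoid 0ℓ 0ℓ
≈-setoid n = record { isEquivalence = ≈-isEquivalence {n = n} }

module ≈-Reasoning (n : ℕ) = SetoidReasoning (≈-setoid n)

+-cong-≈ : a ≈ b [mod n ] → c ≈ d [mod n ] → a + c ≈ b + d [mod n ]
+-cong-≈ {a = a} {b = b} {c = c} {d = d} a≈b c≈d =
  fromSigned diff-+ (ℤ.∣m∣n⇒∣m+n (toSigned a≈b) (toSigned c≈d))
  where
    regroup : ∀ (i j k l : ℤ) → (i ℤ.+ k) ℤ.- (j ℤ.+ l) ≡ (i ℤ.- j) ℤ.+ (k ℤ.- l)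
    regroup = ℤ.solve-∀
    diff-+ : diff (a + c) (b + d) ≡ diff a b ℤ.+ diff c d
    diff-+ rewrite ℤ.pos-+ a c | ℤ.pos-+ b d = regroup (ℤ.+ a) (ℤ.+ b) (ℤ.+ c) (ℤ.+ d)

*-cong-≈ : a ≈ b [mod n ] → c ≈ d [mod n ] → a * c ≈ b * d [mod n ]
*-cong-≈ {a = a} {b = b} {c = c} {d = d} a≈b c≈d =
  fromSigned diff-*
    (ℤ.∣m∣n⇒∣m+n (ℤ.∣m⇒∣m*n (ℤ.+ c) (toSigned a≈b)) (ℤ.∣n⇒∣m*n (ℤ.+ b) (toSigned c≈d)))
  where
    regroup : ∀ (i j k l : ℤ) → i ℤ.* k ℤ.- j ℤ.* l ≡ (i ℤ.- j) ℤ.* k ℤ.+ j ℤ.* (k ℤ.- l)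
    regroup = ℤ.solve-∀
    diff-* : diff (a * c) (b * d) ≡ diff a b ℤ.* ℤ.+ c ℤ.+ ℤ.+ b ℤ.* diff c d
    diff-* rewrite ℤ.pos-* a c | ℤ.pos-* b d = regroup (ℤ.+ a) (ℤ.+ b) (ℤ.+ c) (ℤ.+ d)

^-cong-≈ : ∀ k → a ≈ b [mod n ] → a ^ k ≈ b ^ k [mod n ]
^-cong-≈ zero    a≈b = ≈-refl
^-cong-≈ (suc k) a≈b = *-cong-≈ a≈b (^-cong-≈ k a≈b)

≈-mod-∣ : d ∣ n → a ≈ b [mod n ] → a ≈ b [mod d ]
≈-mod-∣ d∣n (≈-mod a≡b) = ≈-mod (∣-trans d∣n a≡b)

*-scale-≈ : ∀ c → a ≈ b [mod n ] → c * a ≈ c * b [mod c * n ]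
*-scale-≈ {a = a} {b = b} c (≈-mod a≡b) =
  ≈-mod (subst (_ ∣_) (sym (∣diff-scaled∣ c a b)) (*-monoʳ-∣ c a≡b))

*-scale-≈-∣ : d ∣ a → x ≈ t [mod n ] → a * x ≈ a * t [mod d * n ]
*-scale-≈-∣ {d = d} {x = x} {t = t} {n = n} (divides a′ refl) x≈t =
  subst₂ (λ u v → u ≈ v [mod d * n ]) (sym (*-assoc a′ d x)) (sym (*-assoc a′ d t))
    (*-cong-≈ (≈-refl {a′}) (*-scale-≈ d x≈t))

*-cancel-≈-prime : Prime p → ¬ p ∣ c → c * a ≈ c * b [mod p ] → a ≈ b [mod p ]
*-cancel-≈-prime {p = p} {c = c} {a = a} {b = b} p-prime p∤c (≈-mod ca≡cb)
  with euclidsLemma c _ p-prime (subst (p ∣_) (∣diff-scaled∣ c a b) ca≡cb)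
... | inj₁ p∣c = contradiction p∣c p∤c
... | inj₂ a≡b = ≈-mod a≡b

∣⇒≈0 : n ∣ a → a ≈ 0 [mod n ]
∣⇒≈0 {n = n} {a = a} n∣a = ≈-mod (subst (λ z → n ∣ ℤ.∣ z ∣) (sym (ℤ.+-identityʳ (ℤ.+ a))) n∣a)

≈0⇒∣ : a ≈ 0 [mod n ] → n ∣ a
≈0⇒∣ {a = a} {n = n} (≈-mod a≡0) = subst (λ z → n ∣ ℤ.∣ z ∣) (ℤ.+-identityʳ (ℤ.+ a)) a≡0

+-divisible-≈ : n ∣ t → a + t ≈ a [mod n ]
+-divisible-≈ {a = a} n∣t = ≈-trans (+-cong-≈ (≈-refl {a}) (∣⇒≈0 n∣t)) (≡⇒≈ (+-identityʳ a))

-- Finite sums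

∑< : ℕ → (ℕ → ℕ) → ℕ
∑< zero    f = 0
∑< (suc n) f = ∑< n f + f n

syntax ∑< n (λ k → e) = ∑[ k < n ] e

module _ {f g : ℕ → ℕ} where

  ∑-cong : ∀ n → (∀ {k} → k < n → f k ≡ g k) → ∑[ k < n ] f k ≡ ∑[ k < n ] g k
  ∑-cong zero    f≡g = refl
  ∑-cong (suc n) f≡g = cong₂ _+_ (∑-cong n (λ k<n → f≡g (m<n⇒m<1+n k<n))) (f≡g ≤-refl)

  ∑-cong-≈ : ∀ n → (∀ {k} → k < n → f k ≈ g k [mod m ]) →
             ∑[ k < n ] f k ≈ ∑[ k < n ] g k [mod m ]
  ∑-cong-≈ zero    f≈g = ≈-refl
  ∑-cong-≈ (suc n) f≈g = +-cong-≈ (∑-cong-≈ n (λ k<n → f≈g (m<n⇒m<1+n k<n))) (f≈g ≤-refl)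

  ∑-+ : ∀ n → ∑[ k < n ] (f k + g k) ≡ ∑[ k < n ] f k + ∑[ k < n ] g k
  ∑-+ zero    = refl
  ∑-+ (suc n) = trans (cong (_+ (f n + g n)) (∑-+ n)) (interchange (∑< n f) (∑< n g) (f n) (g n))
    where interchange : ∀ a b c d → (a + b) + (c + d) ≡ (a + c) + (b + d)
          interchange = solve-∀

*-distribˡ-∑ : ∀ c (f : ℕ → ℕ) n → c * ∑[ k < n ] f k ≡ ∑[ k < n ] (c * f k)
*-distribˡ-∑ c f zero    = *-zeroʳ c
*-distribˡ-∑ c f (suc n) = trans (*-distribˡ-+ c (∑< n f) (f n)) (cong (_+ c * f n) (*-distribˡ-∑ c f n))

∑-const : ∀ c n → ∑[ k < n ] c ≡ n * c
∑-const c zero    = refl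
∑-const c (suc n) = trans (cong (_+ c) (∑-const c n)) (+-comm (n * c) c)

∑-∣ : ∀ {f : ℕ → ℕ} n → (∀ {k} → k < n → d ∣ f k) → d ∣ ∑[ k < n ] f k
∑-∣ zero    d∣f = _ ∣0
∑-∣ (suc n) d∣f = ∣m∣n⇒∣m+n (∑-∣ n (λ k<n → d∣f (m<n⇒m<1+n k<n))) (d∣f ≤-refl)

∑-suc : ∀ (f : ℕ → ℕ) n → ∑[ k < suc n ] f k ≡ f 0 + ∑[ k < n ] f (suc k)
∑-suc f zero    = +-comm 0 (f 0)
∑-suc f (suc n) = trans (cong (_+ f (suc n)) (∑-suc f n)) (+-assoc (f 0) _ _)

∑-+-range : ∀ (f : ℕ → ℕ) m n → ∑[ k < m + n ] f k ≡ ∑[ k < m ] f k + ∑[ k < n ] f (m + k)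
∑-+-range f m zero    = trans (cong (λ l → ∑< l f) (+-identityʳ m)) (sym (+-identityʳ _))
∑-+-range f m (suc n) = begin
  ∑[ k < m + suc n ] f k                             ≡⟨ cong (λ l → ∑< l f) (+-suc m n) ⟩
  ∑[ k < m + n ] f k + f (m + n)                     ≡⟨ cong (_+ f (m + n)) (∑-+-range f m n) ⟩
  ∑[ k < m ] f k + ∑[ k < n ] f (m + k) + f (m + n)  ≡⟨ +-assoc (∑< m f) _ _ ⟩
  ∑[ k < m ] f k + ∑[ k < suc n ] f (m + k)          ∎
  where open ≡-Reasoning

∑-blocks : ∀ (f : ℕ → ℕ) m n → ∑[ k < m * n ] f k ≡ ∑[ i < m ] ∑[ j < n ] f (i * n + j)
∑-blocks f zero    n = refl
∑-blocks f (suc m) n = begin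
  ∑[ k < n + m * n ] f k                         ≡⟨ cong (λ l → ∑< l f) (+-comm n (m * n)) ⟩
  ∑[ k < m * n + n ] f k                         ≡⟨ ∑-+-range f (m * n) n ⟩
  ∑[ k < m * n ] f k + ∑[ j < n ] f (m * n + j)
    ≡⟨ cong (_+ ∑< n (λ j → f (m * n + j))) (∑-blocks f m n) ⟩
  ∑[ i < suc m ] ∑[ j < n ] f (i * n + j)        ∎
  where open ≡-Reasoning

∑-swap : ∀ (f : ℕ → ℕ → ℕ) m n → ∑[ i < m ] ∑[ j < n ] f i j ≡ ∑[ j < n ] ∑[ i < m ] f i j
∑-swap f zero    n = sym (trans (∑-const 0 n) (*-zeroʳ n))
∑-swap f (suc m) n = begin
  ∑[ i < m ] ∑[ j < n ] f i j + ∑[ j < n ] f m j  ≡⟨ cong (_+ ∑< n (f m)) (∑-swap f m n) ⟩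
  ∑[ j < n ] ∑[ i < m ] f i j + ∑[ j < n ] f m j  ≡⟨ ∑-+ n ⟨
  ∑[ j < n ] ∑[ i < suc m ] f i j                 ∎
  where open ≡-Reasoning

S≡∑ : ∀ r n → S r n ≡ ∑[ k < n ] (suc k ^ r)
S≡∑ r zero    = refl
S≡∑ r (suc n) = cong (_+ suc n ^ r) (S≡∑ r n)

S≡∑+last : ∀ r n → S (suc r) n ≡ ∑[ k < n ] (k ^ suc r) + n ^ suc r
S≡∑+last r n = trans (S≡∑ (suc r) n) (sym (∑-suc (λ k → k ^ suc r) n))

-- Binomial coefficients and Fermat's little theorem

pascal : ∀ n k → suc n C suc k ≡ n C k + n C suc k
pascal n k = sym (nCk+nC[k+1]≡[n+1]C[k+1] n k)

C-absorption : ∀ n k → suc k * (suc n C suc k) ≡ suc n * (n C k)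
C-absorption zero    zero    = refl
C-absorption zero    (suc k) =
  trans (cong (suc (suc k) *_) (k>n⇒nCk≡0 (s<s (z<s {k})))) (*-zeroʳ (suc (suc k)))
C-absorption (suc n) zero    =
  trans (*-identityˡ _) (trans (nC1≡n (suc (suc n))) (sym (*-identityʳ (suc (suc n)))))
C-absorption (suc n) (suc k) = begin
  suc (suc k) * (suc (suc n) C suc (suc k))    ≡⟨ cong (suc (suc k) *_) (pascal (suc n) (suc k)) ⟩
  suc (suc k) * (A + B)                        ≡⟨ expand (suc k) A B ⟩
  A + suc k * A + suc (suc k) * B
    ≡⟨ cong₂ (λ y z → A + y + z) (C-absorption n k) (C-absorption n (suc k)) ⟩
  A + suc n * (n C k) + suc n * (n C suc k)    ≡⟨ +-assoc A _ _ ⟩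
  A + (suc n * (n C k) + suc n * (n C suc k))  ≡⟨ cong (A +_) (*-distribˡ-+ (suc n) (n C k) (n C suc k)) ⟨
  A + suc n * (n C k + n C suc k)              ≡⟨ cong (λ y → A + suc n * y) (pascal n k) ⟨
  suc (suc n) * A                              ∎
  where
    open ≡-Reasoning
    A B : ℕ
    A = suc n C suc k
    B = suc n C suc (suc k)
    expand : ∀ j a b → suc j * (a + b) ≡ a + j * a + suc j * b
    expand = solve-∀

prime∣pCk : Prime p → 0 < k → k < p → p ∣ p C k
prime∣pCk {suc n} {suc j} p-prime 0<k k<p
  with euclidsLemma (suc j) _ p-prime (divides (n C j) (trans (C-absorption n j) (*-comm (suc n) (n C j))))
... | inj₁ p∣k = contradiction (∣⇒≤ p∣k) (<⇒≱ k<p)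
... | inj₂ p∣C = p∣C

binomial-theorem : ∀ x n → (x + 1) ^ n ≡ ∑[ j < suc n ] ((n C j) * x ^ j)
binomial-theorem x zero    = refl
binomial-theorem x (suc n) = begin
  (x + 1) * (x + 1) ^ n
    ≡⟨ cong ((x + 1) *_) (binomial-theorem x n) ⟩
  (x + 1) * B
    ≡⟨ distrib x B ⟩
  x * B + B
    ≡⟨ cong (x * B +_) padded ⟨
  x * B + ∑[ j < suc (suc n) ] ((n C j) * x ^ j)
    ≡⟨ cong (x * B +_) (∑-suc (λ j → (n C j) * x ^ j) (suc n)) ⟩
  x * B + (1 + R)
    ≡⟨ reorder (x * B) R ⟩
  1 + (x * B + R)
    ≡⟨ cong (λ y → 1 + (y + R)) (*-distribˡ-∑ x (λ j → (n C j) * x ^ j) (suc n)) ⟩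
  1 + (∑[ j < suc n ] (x * ((n C j) * x ^ j)) + R)
    ≡⟨ cong (1 +_) (∑-+ (suc n)) ⟨
  1 + ∑[ j < suc n ] (x * ((n C j) * x ^ j) + (n C suc j) * x ^ suc j)
    ≡⟨ cong (1 +_) (∑-cong (suc n) (λ {j} _ → merge x (n C j) (n C suc j) (x ^ j))) ⟩
  1 + ∑[ j < suc n ] ((n C j + n C suc j) * x ^ suc j)
    ≡⟨ cong (1 +_) (∑-cong (suc n) (λ {j} _ → cong (_* x ^ suc j) (pascal n j))) ⟨
  1 + ∑[ j < suc n ] ((suc n C suc j) * x ^ suc j)
    ≡⟨ ∑-suc (λ j → (suc n C j) * x ^ j) (suc n) ⟨
  ∑[ j < suc (suc n) ] ((suc n C j) * x ^ j)
    ∎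
  where
    open ≡-Reasoning
    B R : ℕ
    B = ∑[ j < suc n ] ((n C j) * x ^ j)
    R = ∑[ j < suc n ] ((n C suc j) * x ^ suc j)
    padded : ∑[ j < suc (suc n) ] ((n C j) * x ^ j) ≡ B
    padded = trans (cong (λ z → B + z * x ^ suc n) (k>n⇒nCk≡0 (n<1+n n))) (+-identityʳ B)
    distrib : ∀ x b → (x + 1) * b ≡ x * b + b
    distrib = solve-∀
    reorder : ∀ a r → a + (1 + r) ≡ 1 + (a + r)
    reorder = solve-∀
    merge : ∀ x a b y → x * (a * y) + b * (x * y) ≡ (a + b) * (x * y)
    merge = solve-∀

fermat-little : Prime p → ∀ a → a ^ p ≈ a [mod p ]
fermat-little {suc p-1}     p-prime zero    = ≈-refl
fermat-little {p@(suc p-1)} p-prime (suc a) = begin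
  suc a ^ p
    ≡⟨ cong (_^ p) (+-comm 1 a) ⟩
  (a + 1) ^ p
    ≡⟨ binomial-theorem a p ⟩
  ∑[ j < suc p ] ((p C j) * a ^ j)
    ≡⟨ ∑-suc (λ j → (p C j) * a ^ j) p ⟩
  1 + (∑[ j < p-1 ] ((p C suc j) * a ^ suc j) + (p C p) * a ^ p)
    ≈⟨ +-cong-≈ (≈-refl {1}) middle≈a^p ⟩
  suc (a ^ p)
    ≈⟨ +-cong-≈ (≈-refl {1}) (fermat-little p-prime a) ⟩
  suc a
    ∎
  where
    open ≈-Reasoning p
    middle≈a^p : ∑[ j < p-1 ] ((p C suc j) * a ^ suc j) + (p C p) * a ^ p ≈ a ^ p [mod p ]
    middle≈a^p =
      +-cong-≈ (∣⇒≈0 (∑-∣ p-1 (λ j<p-1 → ∣m⇒∣m*n _ (prime∣pCk p-prime z<s (s<s j<p-1)))))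
               (≡⇒≈ (trans (cong (_* a ^ p) (nCn≡1 p)) (*-identityˡ (a ^ p))))

fermat : Prime p → ¬ p ∣ a → a ^ (p ∸ 1) ≈ 1 [mod p ]
fermat {suc p-1} {a} p-prime p∤a =
  *-cancel-≈-prime p-prime p∤a (≈-trans (fermat-little p-prime a) (≡⇒≈ (sym (*-identityʳ a))))

fermat-^ : Prime p → ¬ p ∣ a → ∀ t → a ^ (t * (p ∸ 1)) ≈ 1 [mod p ]
fermat-^ {p} {a} p-prime p∤a t = begin
  a ^ (t * (p ∸ 1))  ≡⟨ cong (a ^_) (*-comm t (p ∸ 1)) ⟩
  a ^ ((p ∸ 1) * t)  ≡⟨ ^-*-assoc a (p ∸ 1) t ⟨
  (a ^ (p ∸ 1)) ^ t  ≈⟨ ^-cong-≈ t (fermat p-prime p∤a) ⟩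
  1 ^ t              ≡⟨ ^-zeroˡ t ⟩
  1                  ∎
  where open ≈-Reasoning p

^-reduce-mod-prime : Prime p → ∀ a r t → a ^ (suc r + t * (p ∸ 1)) ≈ a ^ suc r [mod p ]
^-reduce-mod-prime {p} p-prime a r t with p ∣? a
... | yes p∣a = ≈-trans (∣⇒≈0 (∣m⇒∣m*n _ p∣a)) (≈-sym (∣⇒≈0 (∣m⇒∣m*n _ p∣a)))
... | no  p∤a = begin
  a ^ (suc r + t * (p ∸ 1))      ≡⟨ ^-distribˡ-+-* a (suc r) (t * (p ∸ 1)) ⟩
  a ^ suc r * a ^ (t * (p ∸ 1))  ≈⟨ *-cong-≈ (≈-refl {a ^ suc r}) (fermat-^ p-prime p∤a t) ⟩
  a ^ suc r * 1                  ≡⟨ *-identityʳ (a ^ suc r) ⟩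
  a ^ suc r                      ∎
  where open ≈-Reasoning p

-- Power sums modulo primes and prime powers

powerSum : ℕ → ℕ → ℕ
powerSum n r = ∑[ k < n ] (k ^ r)

powerSum-recurrence : ∀ n r → ∑[ j < suc r ] ((suc r C j) * powerSum n j) ≡ n ^ suc r
powerSum-recurrence n r = +-cancelˡ-≡ (powerSum n (suc r)) _ _ (begin
  powerSum n (suc r) + ∑[ j < suc r ] ((suc r C j) * powerSum n j)
    ≡⟨ +-comm (powerSum n (suc r)) _ ⟩
  ∑[ j < suc r ] ((suc r C j) * powerSum n j) + powerSum n (suc r)
    ≡⟨ cong (∑< (suc r) (λ j → (suc r C j) * powerSum n j) +_) last-term ⟨
  ∑[ j < suc (suc r) ] ((suc r C j) * powerSum n j)
    ≡⟨ S≡binomial-sum ⟨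
  S (suc r) n
    ≡⟨ S≡∑+last r n ⟩
  powerSum n (suc r) + n ^ suc r
    ∎)
  where
    open ≡-Reasoning
    last-term : (suc r C suc r) * powerSum n (suc r) ≡ powerSum n (suc r)
    last-term = trans (cong (_* powerSum n (suc r)) (nCn≡1 (suc r))) (*-identityˡ _)
    S≡binomial-sum : S (suc r) n ≡ ∑[ j < suc (suc r) ] ((suc r C j) * powerSum n j)
    S≡binomial-sum = begin
      S (suc r) n
        ≡⟨ S≡∑ (suc r) n ⟩
      ∑[ k < n ] (suc k ^ suc r)
        ≡⟨ ∑-cong n (λ {k} _ → trans (cong (_^ suc r) (+-comm 1 k)) (binomial-theorem k (suc r))) ⟩
      ∑[ k < n ] ∑[ j < suc (suc r) ] ((suc r C j) * k ^ j)
        ≡⟨ ∑-swap (λ k j → (suc r C j) * k ^ j) n (suc (suc r)) ⟩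
      ∑[ j < suc (suc r) ] ∑[ k < n ] ((suc r C j) * k ^ j)
        ≡⟨ ∑-cong (suc (suc r)) (λ {j} _ → *-distribˡ-∑ (suc r C j) (λ k → k ^ j) n) ⟨
      ∑[ j < suc (suc r) ] ((suc r C j) * powerSum n j)
        ∎

prime∣powerSum : Prime p → ∀ r → suc r < p → p ∣ powerSum p r
prime∣powerSum {p} p-prime = <-rec (λ r → suc r < p → p ∣ powerSum p r) step
  where
    step : ∀ r → (∀ {j} → j < r → suc j < p → p ∣ powerSum p j) → suc r < p → p ∣ powerSum p r
    step r ih 1+r<p with euclidsLemma (suc r) (powerSum p r) p-prime p∣[1+r]*Pr
      where
        [r+1]Cr≡r+1 : suc r C r ≡ suc r
        [r+1]Cr≡r+1 = trans (nCk≡nC[n∸k] (n≤1+n r)) (trans (cong (suc r C_) (m+n∸n≡m 1 r)) (nC1≡n (suc r)))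
        p∣lower-terms : p ∣ ∑[ j < r ] ((suc r C j) * powerSum p j)
        p∣lower-terms = ∑-∣ r (λ {j} j<r → ∣n⇒∣m*n (suc r C j) (ih j<r (<-trans (s<s j<r) 1+r<p)))
        p∣[1+r]*Pr : p ∣ suc r * powerSum p r
        p∣[1+r]*Pr = subst (λ z → p ∣ z * powerSum p r) [r+1]Cr≡r+1
          (∣m+n∣m⇒∣n (subst (p ∣_) (sym (powerSum-recurrence p r)) (∣m⇒∣m*n (p ^ r) ∣-refl))
                     p∣lower-terms)
    ... | inj₁ p∣1+r = contradiction (∣⇒≤ p∣1+r) (<⇒≱ 1+r<p)
    ... | inj₂ p∣Pr  = p∣Pr

powerSum-≈-p-1 : Prime p → (p ∸ 1) ∣ suc n → powerSum p (suc n) ≈ p ∸ 1 [mod p ]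
powerSum-≈-p-1 {p@(suc p-1)} {n} p-prime (divides t 1+n≡t*[p-1]) = begin
  powerSum p (suc n)                ≡⟨ ∑-suc (λ k → k ^ suc n) p-1 ⟩
  ∑[ k < p-1 ] (suc k ^ suc n)      ≡⟨ ∑-cong p-1 (λ {k} _ → cong (suc k ^_) 1+n≡t*[p-1]) ⟩
  ∑[ k < p-1 ] (suc k ^ (t * p-1))  ≈⟨ ∑-cong-≈ p-1 (λ k<p-1 → fermat-^ p-prime (p∤1+k k<p-1) t) ⟩
  ∑[ k < p-1 ] 1                    ≡⟨ ∑-const 1 p-1 ⟩
  p-1 * 1                           ≡⟨ *-identityʳ p-1 ⟩
  p-1                               ∎
  where
    open ≈-Reasoning p
    p∤1+k : ∀ {k} → k < p-1 → ¬ p ∣ suc k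
    p∤1+k k<p-1 p∣1+k = <⇒≱ (s<s k<p-1) (∣⇒≤ p∣1+k)

powerSum-≈-0 : Prime p → ¬ (p ∸ 1) ∣ N → powerSum p N ≈ 0 [mod p ]
powerSum-≈-0 {p@(suc (suc p-2))} {N} p-prime p-1∤N with N % suc p-2 in N%[p-1] | m%n<n N (suc p-2)
... | zero  | _       = contradiction (m%n≡0⇒n∣m N (suc p-2) N%[p-1]) p-1∤N
... | suc r | 1+r<p-1 = begin
  powerSum p N                      ≡⟨ cong (powerSum p) N≡ ⟩
  powerSum p (suc r + u * (p ∸ 1))  ≈⟨ ∑-cong-≈ p (λ {k} _ → ^-reduce-mod-prime p-prime k r u) ⟩
  powerSum p (suc r)                ≈⟨ ∣⇒≈0 (prime∣powerSum p-prime (suc r) (s<s 1+r<p-1)) ⟩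
  0                                 ∎
  where
    open ≈-Reasoning p
    u : ℕ
    u = N / suc p-2
    N≡ : N ≡ suc r + u * suc p-2
    N≡ = trans (m≡m%n+[m/n]*n N (suc p-2)) (cong (_+ u * suc p-2) N%[p-1])

powerSum-periodic : ∀ L P r → powerSum (L * P) r ≈ L * powerSum P r [mod P ]
powerSum-periodic L P r = begin
  powerSum (L * P) r                       ≡⟨ ∑-blocks (_^ r) L P ⟩
  ∑[ i < L ] ∑[ k < P ] ((i * P + k) ^ r)
    ≈⟨ ∑-cong-≈ L (λ {i} _ → ∑-cong-≈ P (λ {k} _ → ^-cong-≈ r (shift i k))) ⟩
  ∑[ i < L ] powerSum P r                  ≡⟨ ∑-const (powerSum P r) L ⟩
  L * powerSum P r                         ∎
  where
    open ≈-Reasoning P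
    shift : ∀ i k → i * P + k ≈ k [mod P ]
    shift i k = subst (λ z → z ≈ k [mod P ]) (+-comm k (i * P)) (+-divisible-≈ (n∣m*n i))

^-expand-first-order : ∀ a c n → Σ ℕ λ X → (c + a) ^ suc n ≡ a ^ suc n + suc n * a ^ n * c + c * c * X
^-expand-first-order a c zero    = 0 , base a c
  where base : ∀ a c → (c + a) * 1 ≡ a * 1 + 1 * 1 * c + c * c * 0
        base = solve-∀
^-expand-first-order a c (suc n) with ^-expand-first-order a c n
... | X , expansion = a * X + suc n * a ^ n + c * X , trans (cong ((c + a) *_) expansion) (step a c (a ^ n) X n)
  where step : ∀ a c A X n → (c + a) * (a * A + suc n * A * c + c * c * X) ≡
                             a * (a * A) + suc (suc n) * (a * A) * c + c * c * (a * X + suc n * A + c * X)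
        step = solve-∀

module _ {p n} (p-prime : Prime p) (p∣N : p ∣ suc n) where

  ^-lift : ∀ e a b → (b * p ^ suc e + a) ^ suc n ≈ a ^ suc n [mod p ^ suc (suc e) ]
  ^-lift e a b with ^-expand-first-order a (b * p ^ suc e) n
  ... | X , expansion = begin
    (h + a) ^ suc n                              ≡⟨ expansion ⟩
    a ^ suc n + suc n * a ^ n * h + h * h * X    ≡⟨ +-assoc (a ^ suc n) _ _ ⟩
    a ^ suc n + (suc n * a ^ n * h + h * h * X)
      ≈⟨ +-divisible-≈ (∣m∣n⇒∣m+n p²∣linear (∣m⇒∣m*n X p²∣h²)) ⟩
    a ^ suc n                                    ∎
    where
      open ≈-Reasoning (p ^ suc (suc e))
      h : ℕ
      h = b * p ^ suc e
      p²∣linear : p ^ suc (suc e) ∣ suc n * a ^ n * h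
      p²∣linear = *-pres-∣ (∣m⇒∣m*n (a ^ n) p∣N) (n∣m*n b)
      p∣h : p ∣ h
      p∣h = ∣n⇒∣m*n b (∣m⇒∣m*n (p ^ e) ∣-refl)
      p²∣h² : p ^ suc (suc e) ∣ h * h
      p²∣h² = *-pres-∣ p∣h (n∣m*n b)

  powerSum-lift : ∀ e →
    powerSum (p ^ suc (suc e)) (suc n) ≈ p * powerSum (p ^ suc e) (suc n) [mod p ^ suc (suc e) ]
  powerSum-lift e = begin
    powerSum (p ^ suc (suc e)) (suc n)
      ≡⟨ ∑-blocks (_^ suc n) p (p ^ suc e) ⟩
    ∑[ b < p ] ∑[ a < p ^ suc e ] ((b * p ^ suc e + a) ^ suc n)
      ≈⟨ ∑-cong-≈ p (λ {b} _ → ∑-cong-≈ (p ^ suc e) (λ {a} _ → ^-lift e a b)) ⟩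
    ∑[ b < p ] powerSum (p ^ suc e) (suc n)
      ≡⟨ ∑-const _ p ⟩
    p * powerSum (p ^ suc e) (suc n)
      ∎
    where open ≈-Reasoning (p ^ suc (suc e))

  powerSum-primePower : ∀ e → powerSum (p ^ suc e) (suc n) ≈ p ^ e * powerSum p (suc n) [mod p ^ suc e ]
  powerSum-primePower zero    =
    ≡⇒≈ (trans (cong (λ z → powerSum z (suc n)) (*-identityʳ p)) (sym (*-identityˡ _)))
  powerSum-primePower (suc e) = begin
    powerSum (p ^ suc (suc e)) (suc n)  ≈⟨ powerSum-lift e ⟩
    p * powerSum (p ^ suc e) (suc n)    ≈⟨ *-scale-≈ p (powerSum-primePower e) ⟩
    p * (p ^ e * powerSum p (suc n))    ≡⟨ *-assoc p (p ^ e) _ ⟨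
    p ^ suc e * powerSum p (suc n)      ∎
    where open ≈-Reasoning (p ^ suc (suc e))

  S-mod-primePower : ∀ e L → S (suc n) (L * p ^ suc e) ≈ L * (p ^ e * powerSum p (suc n)) [mod p ^ suc e ]
  S-mod-primePower e L = begin
    S (suc n) K                       ≡⟨ S≡∑+last n K ⟩
    powerSum K (suc n) + K ^ suc n    ≈⟨ +-divisible-≈ (∣m⇒∣m*n (K ^ n) (n∣m*n L)) ⟩
    powerSum K (suc n)                ≈⟨ powerSum-periodic L (p ^ suc e) (suc n) ⟩
    L * powerSum (p ^ suc e) (suc n)  ≈⟨ *-cong-≈ (≈-refl {L}) (powerSum-primePower e) ⟩
    L * (p ^ e * powerSum p (suc n))  ∎
    where
      open ≈-Reasoning (p ^ suc e)
      K : ℕ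
      K = L * p ^ suc e

  S-mod-primePower-p-1∣N : suc n ≡ L * p ^ suc e → (p ∸ 1) ∣ suc n →
                           S (suc n) (suc n) ≈ L * (p ^ e * (p ∸ 1)) [mod p ^ suc e ]
  S-mod-primePower-p-1∣N {L} {e} N≡ p-1∣N = begin
    S (suc n) (suc n)                 ≡⟨ cong (S (suc n)) N≡ ⟩
    S (suc n) (L * p ^ suc e)         ≈⟨ S-mod-primePower e L ⟩
    L * (p ^ e * powerSum p (suc n))  ≈⟨ *-cong-≈ (≈-refl {L}) (≈-mod-∣ p^[1+e]∣p^e*p scaled) ⟩
    L * (p ^ e * (p ∸ 1))             ∎
    where
      open ≈-Reasoning (p ^ suc e)
      p^[1+e]∣p^e*p : p ^ suc e ∣ p ^ e * p
      p^[1+e]∣p^e*p = ∣-reflexive (*-comm p (p ^ e))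
      scaled : p ^ e * powerSum p (suc n) ≈ p ^ e * (p ∸ 1) [mod p ^ e * p ]
      scaled = *-scale-≈ (p ^ e) (powerSum-≈-p-1 p-prime p-1∣N)

  S-mod-primePower-p-1∤N : suc n ≡ L * p ^ suc e → ¬ (p ∸ 1) ∣ suc n →
                           S (suc n) (suc n) ≈ 0 [mod p ^ suc e ]
  S-mod-primePower-p-1∤N {L} {e} N≡ p-1∤N = begin
    S (suc n) (suc n)                 ≡⟨ cong (S (suc n)) N≡ ⟩
    S (suc n) (L * p ^ suc e)         ≈⟨ S-mod-primePower e L ⟩
    L * (p ^ e * powerSum p (suc n))  ≈⟨ *-cong-≈ (≈-refl {L}) (≈-mod-∣ p^[1+e]∣p^e*p scaled) ⟩
    L * (p ^ e * 0)                   ≡⟨ cong (L *_) (*-zeroʳ (p ^ e)) ⟩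
    L * 0                             ≡⟨ *-zeroʳ L ⟩
    0                                 ∎
    where
      open ≈-Reasoning (p ^ suc e)
      p^[1+e]∣p^e*p : p ^ suc e ∣ p ^ e * p
      p^[1+e]∣p^e*p = ∣-reflexive (*-comm p (p ^ e))
      scaled : p ^ e * powerSum p (suc n) ≈ p ^ e * 0 [mod p ^ e * p ]
      scaled = *-scale-≈ (p ^ e) (powerSum-≈-0 p-prime p-1∤N)

-- Prime-power decomposition

m*n>0 : m > 0 → n > 0 → m * n > 0
m*n>0 {suc m} {suc n} _ _ = z<s

m*n>0⇒m>0 : ∀ m {n} → m * n > 0 → m > 0
m*n>0⇒m>0 (suc m) _ = z<s

prime∤pred : Prime p → ¬ p ∣ p ∸ 1
prime∤pred {suc (suc p-2)} _ p∣p-1 = <⇒≱ ≤-refl (∣⇒≤ p∣p-1)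

prime^-euclid : Prime p → ¬ p ∣ a → ∀ e → p ^ e ∣ a * b → p ^ e ∣ b
prime^-euclid p-prime p∤a zero    _ = 1∣ _
prime^-euclid {p} {a} {b} p-prime p∤a (suc e) p^e∣ab
  with euclidsLemma a b p-prime (∣-trans (∣m⇒∣m*n (p ^ e) ∣-refl) p^e∣ab)
... | inj₁ p∣a = contradiction p∣a p∤a
... | inj₂ (divides w refl) = subst (λ z → p * p ^ e ∣ z) (*-comm p w) (*-monoʳ-∣ p p^e∣w)
  where
    instance _ = prime⇒nonZero p-prime
    regroup : ∀ a w p → a * (w * p) ≡ p * (a * w)
    regroup = solve-∀
    p^e∣w : p ^ e ∣ w
    p^e∣w = prime^-euclid p-prime p∤a e (*-cancelˡ-∣ p (subst (p * p ^ e ∣_) (regroup a w p) p^e∣ab))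

prime∣prime^⇒≡ : Prime q → Prime p → q ∣ p ^ e → q ≡ p
prime∣prime^⇒≡ {e = zero}  q-prime p-prime q∣1   =
  contradiction (subst Prime (∣1⇒≡1 q∣1) q-prime) ¬prime[1]
prime∣prime^⇒≡ {e = suc e} q-prime p-prime q∣p^e with euclidsLemma _ _ q-prime q∣p^e
... | inj₂ q∣p^e = prime∣prime^⇒≡ {e = e} q-prime p-prime q∣p^e
... | inj₁ q∣p with prime⇒irreducible p-prime q∣p
...   | inj₁ q≡1 = contradiction (subst Prime q≡1 q-prime) ¬prime[1]
...   | inj₂ q≡p = q≡p

prime-divisor : ∀ M → 1 < M → Σ ℕ λ q → Prime q × q ∣ M
prime-divisor M 1<M with factorise M {{>-nonZero (<-trans z<s 1<M)}}
... | record { factors = [] ; isFactorisation = M≡1 } = contradiction M≡1 (>⇒≢ 1<M)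
... | record { factors = q ∷ _ ; isFactorisation = M≡ ; factorsPrime = q-prime ∷ _ } =
  q , q-prime , subst (q ∣_) (sym M≡) (m∣m*n _)

PrimePowerSplit : ℕ → ℕ → Set
PrimePowerSplit p M = Σ ℕ λ e → Σ ℕ λ L → M ≡ L * p ^ e × ¬ p ∣ L

primePower-split : Prime p → ∀ M → 0 < M → PrimePowerSplit p M
primePower-split {p} p-prime = <-rec (λ M → 0 < M → PrimePowerSplit p M) split
  where
    split : ∀ M → (∀ {K} → K < M → 0 < K → PrimePowerSplit p K) → 0 < M → PrimePowerSplit p M
    split M rec 0<M with p ∣? M
    ... | no  p∤M = 0 , M , sym (*-identityʳ M) , p∤M
    ... | yes (divides K M≡K*p) with rec K<M 0<K
      where
        0<K : 0 < K
        0<K = m*n>0⇒m>0 K (subst (0 <_) M≡K*p 0<M)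
        K<M : K < M
        K<M = subst (K <_) (sym M≡K*p)
                (m<m*n K p {{>-nonZero 0<K}} (nonTrivial⇒n>1 p {{prime⇒nonTrivial p-prime}}))
    ...   | e , L , K≡ , p∤L = suc e , L , trans M≡K*p (trans (cong (_* p) K≡) (regroup L (p ^ e) p)) , p∤L
      where regroup : ∀ L x p → L * x * p ≡ L * (p * x)
            regroup = solve-∀

primePower-split⁺ : Prime p → 0 < M → p ∣ M → Σ ℕ λ e → Σ ℕ λ L → M ≡ L * p ^ suc e × ¬ p ∣ L
primePower-split⁺ {p} {M} p-prime 0<M p∣M with primePower-split p-prime M 0<M
... | zero  , L , M≡L*1 , p∤L = contradiction (subst (p ∣_) (trans M≡L*1 (*-identityʳ L)) p∣M) p∤L
... | suc e , L , M≡ , p∤L     = e , L , M≡ , p∤L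

∣-combine : Prime p → ¬ p ∣ L → L ∣ t → p ^ e ∣ t → L * p ^ e ∣ t
∣-combine {p} {L} {e = e} p-prime p∤L (divides w refl) p^e∣t =
  subst (L * p ^ e ∣_) (*-comm L w)
    (*-monoʳ-∣ L (prime^-euclid p-prime p∤L e (subst (p ^ e ∣_) (*-comm w L) p^e∣t)))

∣-byPrimePowers : ∀ M → 0 < M →
  (∀ q e L → Prime q → M ≡ L * q ^ suc e → ¬ q ∣ L → q ^ suc e ∣ t) → M ∣ t
∣-byPrimePowers {t} = <-rec (λ M → 0 < M → PrimePowerParts∣ M → M ∣ t) glue
  where
    PrimePowerParts∣ : ℕ → Set
    PrimePowerParts∣ M = ∀ q e L → Prime q → M ≡ L * q ^ suc e → ¬ q ∣ L → q ^ suc e ∣ t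

    glue : ∀ M → (∀ {K} → K < M → 0 < K → PrimePowerParts∣ K → K ∣ t) →
           0 < M → PrimePowerParts∣ M → M ∣ t
    glue M rec 0<M parts with M ≟ 1
    ... | yes refl = 1∣ t
    ... | no  M≢1  with prime-divisor M (≤∧≢⇒< 0<M (M≢1 ∘ sym))
    ...   | p , p-prime , p∣M with primePower-split⁺ p-prime 0<M p∣M
    ...     | e , L , M≡ , p∤L =
      subst (_∣ t) (sym M≡) (∣-combine {e = suc e} p-prime p∤L L∣t (parts p e L p-prime M≡ p∤L))
      where
        0<L : 0 < L
        0<L = m*n>0⇒m>0 L (subst (0 <_) M≡ 0<M)
        L<M : L < M
        L<M = subst (L <_) (sym M≡) (m<m*n L (p ^ suc e) {{>-nonZero 0<L}}
                (^-monoʳ-< p (nonTrivial⇒n>1 p {{prime⇒nonTrivial p-prime}}) {0} {suc e} z<s))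
        L-parts : PrimePowerParts∣ L
        L-parts q e′ L′ q-prime L≡ q∤L′ = parts q e′ (L′ * p ^ suc e) q-prime M≡′ q∤L′p^e
          where
            regroup : ∀ a b c → a * b * c ≡ a * c * b
            regroup = solve-∀
            M≡′ : M ≡ L′ * p ^ suc e * q ^ suc e′
            M≡′ = trans M≡ (trans (cong (_* p ^ suc e) L≡) (regroup L′ (q ^ suc e′) (p ^ suc e)))
            q∤L′p^e : ¬ q ∣ L′ * p ^ suc e
            q∤L′p^e q∣L′p^e with euclidsLemma L′ (p ^ suc e) q-prime q∣L′p^e
            ... | inj₁ q∣L′  = q∤L′ q∣L′
            ... | inj₂ q∣p^e with prime∣prime^⇒≡ {e = suc e} q-prime p-prime q∣p^e
            ...   | refl = p∤L (subst (q ∣_) (sym L≡) (∣n⇒∣m*n L′ (∣m⇒∣m*n (q ^ e′) ∣-refl)))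
        L∣t : L ∣ t
        L∣t = rec L<M 0<L L-parts

-- Obstructing primes

Obstructs : ℕ → ℕ → ℕ → Set
Obstructs Q m p = Prime p × p ∣ m × ¬ p ∣ Q × (p ∸ 1) ∣ Q * m

obstructed? : ∀ Q m → 0 < m → Dec (Σ ℕ (Obstructs Q m))
obstructed? Q m 0<m
  with anyUpTo? (λ p → prime? p ×-dec p ∣? m ×-dec ¬? (p ∣? Q) ×-dec (p ∸ 1) ∣? Q * m) (suc m)
... | yes (p , _ , obstructs) = yes (p , obstructs)
... | no  none                = no λ (p , obstructs) →
  none (p , s≤s (∣⇒≤ {{>-nonZero 0<m}} (proj₁ (proj₂ obstructs))) , obstructs)

obstruction⇒S≉ : Obstructs Q m p → suc n ≡ Q * m → ¬ S (suc n) (suc n) ≈ m [mod suc n ]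
obstruction⇒S≉ {Q} {m} {p} {n} (p-prime , p∣m , p∤Q , p-1∣Qm) N≡Qm S≈m =
  let e , L , N≡ , p∤L = primePower-split⁺ p-prime z<s p∣N
  in [ p∤L , prime∤pred p-prime ]′ (euclidsLemma L (p ∸ 1) p-prime (p∣L[p-1] {L = L} {e = e} N≡))
  where
    p∣N : p ∣ suc n
    p∣N = subst (p ∣_) (sym N≡Qm) (∣n⇒∣m*n Q p∣m)
    p∣L[p-1] : suc n ≡ L * p ^ suc e → p ∣ L * (p ∸ 1)
    p∣L[p-1] {L = L} {e = e} N≡ = *-cancelˡ-∣ (p ^ e) {{m^n≢0 p e {{prime⇒nonZero p-prime}}}}
      (subst₂ _∣_ (*-comm p (p ^ e)) (regroup L (p ^ e) (p ∸ 1))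
        (≈0⇒∣ (≈-trans (≈-sym S≈L[p^e[p-1]]) S≈0)))
      where
        regroup : ∀ L a b → L * (a * b) ≡ a * (L * b)
        regroup = solve-∀
        p^[1+e]∣m : p ^ suc e ∣ m
        p^[1+e]∣m = prime^-euclid p-prime p∤Q (suc e) (subst (p ^ suc e ∣_) (trans (sym N≡) N≡Qm) (n∣m*n L))
        S≈L[p^e[p-1]] : S (suc n) (suc n) ≈ L * (p ^ e * (p ∸ 1)) [mod p ^ suc e ]
        S≈L[p^e[p-1]] =
          S-mod-primePower-p-1∣N p-prime p∣N {L = L} {e = e} N≡ (subst ((p ∸ 1) ∣_) (sym N≡Qm) p-1∣Qm)
        S≈0 : S (suc n) (suc n) ≈ 0 [mod p ^ suc e ]
        S≈0 = ≈-trans (≈-mod-∣ (subst (p ^ suc e ∣_) (sym N≡) (n∣m*n L)) S≈m) (∣⇒≈0 p^[1+e]∣m)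

obstruction⇒∉N : Q * m > 0 → Obstructs Q m p → ¬ InN Q m
obstruction⇒∉N {Q} {m} Qm>0 obstructs (_ , S≡m) = S≉m (Q * m) refl Qm>0 (≈-mod S≡m)
  where
    S≉m : ∀ N → N ≡ Q * m → N > 0 → ¬ S N N ≈ m [mod N ]
    S≉m (suc n) N≡Qm _ = obstruction⇒S≉ obstructs N≡Qm

obstruction-quotient : Prime p → 0 < m → p ∣ m → (p ∸ 1) ∣ Q * m →
                       Σ ℕ λ K → K ≥ 1 × m * gcd Q (p ∸ 1) ≡ K * (p * (p ∸ 1))
obstruction-quotient {p@(suc (suc p-2))} {m} {Q} p-prime 0<m p∣m p-1∣Qm = K , K≥1 , m*g≡K*p*[p-1]
  where
    g : ℕ
    g = gcd Q (p ∸ 1)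
    instance _ = ≢-nonZero (gcd[m,n]≢0 Q (p ∸ 1) (inj₂ λ ()))
    r : ℕ
    r = quotient (gcd[m,n]∣n Q (p ∸ 1))
    p-1≡r*g : p ∸ 1 ≡ r * g
    p-1≡r*g = _∣_.equality (gcd[m,n]∣n Q (p ∸ 1))
    p-1∣m*g : p ∸ 1 ∣ m * g
    p-1∣m*g = subst (p ∸ 1 ∣_) (sym (c*gcd[m,n]≡gcd[cm,cn] m Q (p ∸ 1)))
                (gcd-greatest (subst (p ∸ 1 ∣_) (*-comm Q m) p-1∣Qm) (n∣m*n m))
    r∣m : r ∣ m
    r∣m = *-cancelʳ-∣ g (subst (_∣ m * g) p-1≡r*g p-1∣m*g)
    m₁ : ℕ
    m₁ = quotient r∣m
    p∤r : ¬ p ∣ r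
    p∤r p∣r = prime∤pred p-prime (∣-trans p∣r (divides g (trans p-1≡r*g (*-comm r g))))
    p∣m₁ : p ∣ m₁
    p∣m₁ = [ id , (λ p∣r → contradiction p∣r p∤r) ]′
             (euclidsLemma m₁ r p-prime (subst (p ∣_) (_∣_.equality r∣m) p∣m))
    K : ℕ
    K = quotient p∣m₁
    m*g≡K*p*[p-1] : m * g ≡ K * (p * (p ∸ 1))
    m*g≡K*p*[p-1] = begin
      m * g              ≡⟨ cong (_* g) (_∣_.equality r∣m) ⟩
      m₁ * r * g         ≡⟨ cong (λ z → z * r * g) (_∣_.equality p∣m₁) ⟩
      K * p * r * g      ≡⟨ regroup K p r g ⟩
      K * (p * (r * g))  ≡⟨ cong (λ z → K * (p * z)) p-1≡r*g ⟨
      K * (p * (p ∸ 1))  ∎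
      where
        open ≡-Reasoning
        regroup : ∀ K p a g → K * p * a * g ≡ K * (p * (a * g))
        regroup = solve-∀
    K≥1 : K ≥ 1
    K≥1 = m*n>0⇒m>0 K (subst (0 <_) m*g≡K*p*[p-1] (m*n>0 0<m (>-nonZero⁻¹ g)))

W-cofactor : Prime p → d ∣ p ∸ 1 → m * d ≡ x * (p * (p ∸ 1)) →
             Σ ℕ λ c → p ∸ 1 ≡ c * d × m ≡ x * p * c
W-cofactor {p@(suc (suc p-2))} {d} {m} {x} p-prime (divides c p-1≡c*d) m*d≡ = c , p-1≡c*d , m≡x*p*c
  where
    instance _ = ≢-nonZero {d} λ { refl → contradiction (trans p-1≡c*d (*-zeroʳ c)) λ () }
    regroup : ∀ x p c d → x * (p * (c * d)) ≡ x * p * c * d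
    regroup = solve-∀
    m≡x*p*c : m ≡ x * p * c
    m≡x*p*c = *-cancelʳ-≡ m (x * p * c) d
      (trans m*d≡ (trans (cong (λ y → x * (p * y)) p-1≡c*d) (regroup x p c d)))

W⇒obstructs : d ∣ Q → Prime p → ¬ p ∣ Q → d ∣ p ∸ 1 → x ≥ 1 → m * d ≡ x * (p * (p ∸ 1)) →
              m > 0 × Obstructs Q m p
W⇒obstructs {d} {Q} {p@(suc (suc p-2))} {x} {m} (divides Q′ Q≡Q′d) p-prime p∤Q d∣p-1 x≥1 m*d≡
  with W-cofactor {x = x} p-prime d∣p-1 m*d≡
... | c , p-1≡c*d , m≡x*p*c = m>0 , p-prime , p∣m , p∤Q , p-1∣Qm
  where
    m>0 : m > 0
    m>0 = subst (_> 0) (sym m≡x*p*c) (m*n>0 (m*n>0 x≥1 z<s) (m*n>0⇒m>0 c (subst (_> 0) p-1≡c*d z<s)))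
    p∣m : p ∣ m
    p∣m = subst (p ∣_) (sym m≡x*p*c) (∣m⇒∣m*n c (n∣m*n x))
    regroup : ∀ Q′ d x p c → Q′ * d * (x * p * c) ≡ Q′ * x * p * (c * d)
    regroup = solve-∀
    p-1∣Qm : p ∸ 1 ∣ Q * m
    p-1∣Qm = divides (Q′ * x * p) (begin
      Q * m                 ≡⟨ cong₂ _*_ Q≡Q′d m≡x*p*c ⟩
      Q′ * d * (x * p * c)  ≡⟨ regroup Q′ d x p c ⟩
      Q′ * x * p * (c * d)  ≡⟨ cong (Q′ * x * p *_) p-1≡c*d ⟨
      Q′ * x * p * (p ∸ 1)  ∎)
      where open ≡-Reasoning

-- The moduli Q

-- The second condition says q ∣ Q/q + 1, stated without division.
PrimeDivisorCondition : ℕ → ℕ → Set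
PrimeDivisorCondition Q q = (q ∸ 1) ∣ 5 * Q × q * q ∣ Q + q

record Admissible (Q : ℕ) : Set where
  field
    0<Q            : 0 < Q
    5∤Q            : ¬ 5 ∣ Q
    prime-divisors : ∀ {q} → Prime q → q ∣ Q → PrimeDivisorCondition Q q

prime[5] : Prime 5
prime[5] = from-yes (prime? 5)

module _ {Q} (admissible : Admissible Q) where
  open Admissible admissible

  S≈m-at-prime∣Q : 5 ∣ m → suc n ≡ Q * m → Prime q → q ∣ Q → suc n ≡ L * q ^ suc e →
                   S (suc n) (suc n) ≈ m [mod q ^ suc e ]
  S≈m-at-prime∣Q {m} {n} {q@(suc q-1)} {L} {e} 5∣m N≡Qm q-prime q∣Q@(divides Q′ Q≡Q′q) N≡ = begin
    S (suc n) (suc n)      ≈⟨ S-mod-primePower-p-1∣N q-prime q∣N {L = L} {e = e} N≡ q-1∣N ⟩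
    L * (q ^ e * q-1)      ≡⟨ regroup L (q ^ e) q-1 Q′ m Q′m≡Lq^e ⟩
    m * (Q′ * q-1)         ≈⟨ ≈-mod-∣ q^[1+e]∣q^e*q (*-scale-≈-∣ q^e∣m Q′[q-1]≈1) ⟩
    m * 1                  ≡⟨ *-identityʳ m ⟩
    m                      ∎
    where
      open ≈-Reasoning (q ^ suc e)
      instance _ = prime⇒nonZero q-prime
      q^[1+e]∣q^e*q : q ^ suc e ∣ q ^ e * q
      q^[1+e]∣q^e*q = ∣-reflexive (*-comm q (q ^ e))
      q∣N : q ∣ suc n
      q∣N = subst (q ∣_) (sym N≡) (∣n⇒∣m*n L (∣m⇒∣m*n (q ^ e) ∣-refl))
      q-1∣N : q-1 ∣ suc n
      q-1∣N = subst (q-1 ∣_) (sym N≡Qm)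
        (∣-trans (proj₁ (prime-divisors q-prime q∣Q)) (subst (_∣ Q * m) (*-comm Q 5) (*-monoʳ-∣ Q 5∣m)))
      Q′m≡Lq^e : Q′ * m ≡ L * q ^ e
      Q′m≡Lq^e = *-cancelʳ-≡ _ _ q
        (trans (swap Q′ m q)
          (trans (cong (_* m) (sym Q≡Q′q)) (trans (trans (sym N≡Qm) N≡) (rotate L q (q ^ e)))))
        where swap : ∀ a b c → a * b * c ≡ a * c * b
              swap = solve-∀
              rotate : ∀ a b c → a * (b * c) ≡ a * c * b
              rotate = solve-∀
      q∣1+Q′ : q ∣ suc Q′
      q∣1+Q′ = *-cancelˡ-∣ q (subst (q * q ∣_) (trans (cong (_+ q) Q≡Q′q) (factor Q′ q))
                                                (proj₂ (prime-divisors q-prime q∣Q)))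
        where factor : ∀ a b → a * b + b ≡ b * suc a
              factor = solve-∀
      q∤Q′ : ¬ q ∣ Q′
      q∤Q′ q∣Q′ = ¬prime[1] (subst Prime q≡1 q-prime)
        where q≡1 : q ≡ 1
              q≡1 = ∣1⇒≡1 (∣m+n∣m⇒∣n (subst (q ∣_) (+-comm 1 Q′) q∣1+Q′) q∣Q′)
      q^e∣m : q ^ e ∣ m
      q^e∣m = prime^-euclid q-prime q∤Q′ e (subst (q ^ e ∣_) (sym Q′m≡Lq^e) (n∣m*n L))
      Q′[q-1]≈1 : Q′ * q-1 ≈ 1 [mod q ]
      Q′[q-1]≈1 = ≈-trans (≈-sym (+-divisible-≈ q∣1+Q′))
                    (≈-trans (≡⇒≈ (expand Q′ q-1)) (+-divisible-≈ (n∣m*n Q′)))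
        where expand : ∀ a b → a * b + suc a ≡ 1 + a * suc b
              expand = solve-∀
      regroup : ∀ L a b Q′ m → Q′ * m ≡ L * a → L * (a * b) ≡ m * (Q′ * b)
      regroup L a b Q′ m eq = trans (sym (*-assoc L a b)) (trans (cong (_* b) (sym eq)) (swap Q′ m b))
        where swap : ∀ a b c → a * b * c ≡ b * (a * c)
              swap = solve-∀

  S≈m-at-prime∤Q : (∀ p → ¬ Obstructs Q m p) → suc n ≡ Q * m → Prime q → ¬ q ∣ Q →
                   suc n ≡ L * q ^ suc e → S (suc n) (suc n) ≈ m [mod q ^ suc e ]
  S≈m-at-prime∤Q {m} {n} {q} {L} {e} unobstructed N≡Qm q-prime q∤Q N≡ = by-cases ((q ∸ 1) ∣? suc n)
    where
      q∣N : q ∣ suc n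
      q∣N = subst (q ∣_) (sym N≡) (∣n⇒∣m*n L (∣m⇒∣m*n (q ^ e) ∣-refl))
      q^[1+e]∣m : q ^ suc e ∣ m
      q^[1+e]∣m = prime^-euclid q-prime q∤Q (suc e) (subst (q ^ suc e ∣_) (trans (sym N≡) N≡Qm) (n∣m*n L))
      q∣m : q ∣ m
      q∣m = ∣-trans (∣m⇒∣m*n (q ^ e) ∣-refl) q^[1+e]∣m
      by-cases : Dec ((q ∸ 1) ∣ suc n) → S (suc n) (suc n) ≈ m [mod q ^ suc e ]
      by-cases (yes q-1∣N) =
        contradiction (q-prime , q∣m , q∤Q , subst ((q ∸ 1) ∣_) N≡Qm q-1∣N) (unobstructed q)
      by-cases (no  q-1∤N) =
        ≈-trans (S-mod-primePower-p-1∤N q-prime q∣N {L = L} {e = e} N≡ q-1∤N) (≈-sym (∣⇒≈0 q^[1+e]∣m))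

  unobstructed⇒S≈m : 5 ∣ m → 0 < m → (∀ p → ¬ Obstructs Q m p) → S (Q * m) (Q * m) ≈ m [mod Q * m ]
  unobstructed⇒S≈m {m} 5∣m 0<m unobstructed = S≈m (Q * m) refl (m*n>0 0<Q 0<m)
    where
      S≈m : ∀ N → N ≡ Q * m → N > 0 → S N N ≈ m [mod N ]
      S≈m (suc n) N≡Qm _ = ≈-mod (∣-byPrimePowers (suc n) z<s at-prime-power)
        where
          at-prime-power : ∀ q e L → Prime q → suc n ≡ L * q ^ suc e → ¬ q ∣ L →
                           q ^ suc e ∣ ℤ.∣ ℤ.+ S (suc n) (suc n) ℤ.- ℤ.+ m ∣
          at-prime-power q e L q-prime N≡ _ with q ∣? Q
          ... | yes q∣Q = ≡-mod (S≈m-at-prime∣Q {L = L} {e = e} 5∣m N≡Qm q-prime q∣Q N≡)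
          ... | no  q∤Q = ≡-mod (S≈m-at-prime∤Q {L = L} {e = e} unobstructed N≡Qm q-prime q∤Q N≡)

  obstructed⇒W : 5 ∣ m → 0 < m → Obstructs Q m p → Σ ℕ λ d → d ∣ Q × (W1 Q d m ⊎ W2 Q d m)
  obstructed⇒W {m} {p} 5∣m 0<m (p-prime , p∣m , p∤Q , p-1∣Qm)
    with obstruction-quotient {Q = Q} p-prime 0<m p∣m p-1∣Qm | 5 ∣? p * (p ∸ 1)
  ... | K , K≥1 , m*g≡ | yes 5∣p[p-1] =
    gcd Q (p ∸ 1) , gcd[m,n]∣m Q (p ∸ 1) ,
    inj₁ (p , K , p-prime , p∤Q , 5∣p[p-1] , gcd[m,n]∣n Q (p ∸ 1) , K≥1 , m*g≡)
  ... | K , K≥1 , m*g≡ | no  5∤p[p-1] with euclidsLemma K (p * (p ∸ 1)) prime[5] 5∣K*p[p-1]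
    where
      5∣K*p[p-1] : 5 ∣ K * (p * (p ∸ 1))
      5∣K*p[p-1] = subst (5 ∣_) m*g≡ (∣m⇒∣m*n (gcd Q (p ∸ 1)) 5∣m)
  ...   | inj₂ 5∣p[p-1]            = contradiction 5∣p[p-1] 5∤p[p-1]
  ...   | inj₁ (divides K′ K≡K′*5) =
    gcd Q (p ∸ 1) , gcd[m,n]∣m Q (p ∸ 1) ,
    inj₂ (p , K′ , p-prime , p∤Q , 5∤p[p-1] , gcd[m,n]∣n Q (p ∸ 1) , K′≥1 ,
          trans m*g≡ (cong (_* (p * (p ∸ 1))) (trans K≡K′*5 (*-comm K′ 5))))
    where
      K′≥1 : K′ ≥ 1
      K′≥1 = m*n>0⇒m>0 K′ (subst (_> 0) K≡K′*5 K≥1)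

  W⇒5∣m : d ∣ Q → W1 Q d m ⊎ W2 Q d m → 5 ∣ m
  W⇒5∣m {d} d∣Q (inj₁ (p , K , p-prime , _ , 5∣p[p-1] , d∣p-1 , _ , m*d≡))
    with W-cofactor {x = K} p-prime d∣p-1 m*d≡
  ... | c , p-1≡c*d , m≡K*p*c =
    subst (5 ∣_) (sym m≡K*p*c) (5∣K*p*c (subst (λ y → 5 ∣ p * y) p-1≡c*d 5∣p[p-1]))
    where
      5∣K*p*c : 5 ∣ p * (c * d) → 5 ∣ K * p * c
      5∣K*p*c 5∣p[cd] with euclidsLemma p (c * d) prime[5] 5∣p[cd]
      ... | inj₁ 5∣p  = ∣m⇒∣m*n c (∣n⇒∣m*n K 5∣p)
      ... | inj₂ 5∣cd with euclidsLemma c d prime[5] 5∣cd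
      ...   | inj₁ 5∣c = ∣n⇒∣m*n (K * p) 5∣c
      ...   | inj₂ 5∣d = contradiction (∣-trans 5∣d d∣Q) 5∤Q
  W⇒5∣m {d} d∣Q (inj₂ (p , K , p-prime , _ , _ , d∣p-1 , _ , m*d≡))
    with W-cofactor {x = 5 * K} p-prime d∣p-1 m*d≡
  ... | c , _ , m≡5K*p*c = subst (5 ∣_) (sym m≡5K*p*c) (∣m⇒∣m*n c (∣m⇒∣m*n p (m∣m*n K)))

  W⇒obstructed : d ∣ Q → W1 Q d m ⊎ W2 Q d m → m > 0 × Σ ℕ (Obstructs Q m)
  W⇒obstructed d∣Q (inj₁ (p , K , p-prime , p∤Q , _ , d∣p-1 , K≥1 , m*d≡)) =
    let m>0 , obstructs = W⇒obstructs d∣Q p-prime p∤Q d∣p-1 K≥1 m*d≡ in m>0 , p , obstructs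
  W⇒obstructed d∣Q (inj₂ (p , K , p-prime , p∤Q , _ , d∣p-1 , K≥1 , m*d≡)) =
    let m>0 , obstructs = W⇒obstructs d∣Q p-prime p∤Q d∣p-1 (m*n>0 {5} z<s K≥1) m*d≡ in m>0 , p , obstructs

  characterisation : ∀ m → ((Σ ℕ λ k → (k ≥ 1) × (m ≡ 5 * k)) × ¬ InN Q m) ⇔
                           (Σ ℕ λ d → (d ∣ Q) × (W1 Q d m ⊎ W2 Q d m))
  characterisation m = mk⇔ to from
    where
      In5ℕ∖𝔑 In⋃W : Set
      In5ℕ∖𝔑 = (Σ ℕ λ k → (k ≥ 1) × (m ≡ 5 * k)) × ¬ InN Q m
      In⋃W   = Σ ℕ λ d → (d ∣ Q) × (W1 Q d m ⊎ W2 Q d m)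
      to : In5ℕ∖𝔑 → In⋃W
      to ((k , k≥1 , m≡5k) , m∉N) = by-cases (obstructed? Q m 0<m)
        where
          0<m : 0 < m
          0<m = subst (_> 0) (sym m≡5k) (m*n>0 {5} z<s k≥1)
          5∣m : 5 ∣ m
          5∣m = divides k (trans m≡5k (*-comm 5 k))
          by-cases : Dec (Σ ℕ (Obstructs Q m)) → In⋃W
          by-cases (yes (p , obstructs)) = obstructed⇒W 5∣m 0<m obstructs
          by-cases (no  unobstructed)    =
            contradiction (0<m , ≡-mod (unobstructed⇒S≈m 5∣m 0<m λ p o → unobstructed (p , o))) m∉N
      from : In⋃W → In5ℕ∖𝔑
      from (d , d∣Q , w) with W⇒obstructed d∣Q w | W⇒5∣m d∣Q w
      ... | m>0 , p , obstructs | divides k m≡k*5 =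
        (k , m*n>0⇒m>0 k (subst (_> 0) m≡k*5 m>0) , trans m≡k*5 (*-comm k 5)) ,
        obstruction⇒∉N (m*n>0 0<Q m>0) obstructs

primeDivisorCondition? : ∀ Q q → Dec (PrimeDivisorCondition Q q)
primeDivisorCondition? Q q = (q ∸ 1) ∣? 5 * Q ×-dec q * q ∣? Q + q

admissible-byFactorisation : ∀ ps → Q ≡ product ps → All Prime ps → All (PrimeDivisorCondition Q) ps →
                             0 < Q → ¬ 5 ∣ Q → Admissible Q
admissible-byFactorisation ps Q≡Πps primes conditions 0<Q 5∤Q = record
  { 0<Q            = 0<Q
  ; 5∤Q            = 5∤Q
  ; prime-divisors = λ q-prime q∣Q →
      All.lookup conditions (factorisationHasAllPrimeFactors q-prime (subst (_ ∣_) Q≡Πps q∣Q) primes)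
  }

admissible[47058] : Admissible 47058
admissible[47058] = admissible-byFactorisation ps refl
  (from-yes (All.all? prime? ps)) (from-yes (All.all? (primeDivisorCondition? 47058) ps)) z<s (from-no (5 ∣? 47058))
  where ps = 2 ∷ 3 ∷ 11 ∷ 23 ∷ 31 ∷ []

admissible[2214502422] : Admissible 2214502422
admissible[2214502422] = admissible-byFactorisation ps refl
  (from-yes (All.all? prime? ps)) (from-yes (All.all? (primeDivisorCondition? 2214502422) ps))
  z<s (from-no (5 ∣? 2214502422))
  where ps = 2 ∷ 3 ∷ 11 ∷ 23 ∷ 31 ∷ 47059 ∷ []

corollary3 : (Q : ℕ) → (Q ≡ 47058 ⊎ Q ≡ 2214502422) → (m : ℕ) →
    ((Σ ℕ λ k → (k ≥ 1) × (m ≡ 5 * k)) × ¬ InN Q m) ⇔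
    (Σ ℕ λ d → (d ∣ Q) × (W1 Q d m ⊎ W2 Q d m))
corollary3 Q (inj₁ refl) = characterisation {Q = 47058} admissible[47058]
corollary3 Q (inj₂ refl) = characterisation {Q = 2214502422} admissible[2214502422]
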